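{- Let $\{b_2(n)\}_{n=0}^\infty$ be the Bell numbers, defined by $e^{e^x-1}=\sum_{n=0}^\infty \frac{b_2(n)}{n!}x^n$. Then $b_2(n+m)\leq 2^{n+m}b_2(n)b_2(m)$ for all $n,m\geq 0$, and $2$ is the best such constant: if $c$ is a constant with $b_2(n+m)\leq c^{n+m}b_2(n)b_2(m)$ for all $n,m\geq 0$, then $c\geq 2$.
   Formalization: In the optimality clause, the constant c ranges only over the rationals. -}

module Defs where

open import Data.Nat using (ℕ; zero; suc; _+_; _*_)
open import Data.Integer using (+_)
open import Data.Rational using (ℚ; _/_; 1ℚ) renaming (_*_ to _*ℚ_)

stirling2 : ℕ → ℕ → ℕ
stirling2 zero    zero    = 1
stirling2 zero    (suc k) = 0
stirling2 (suc n) zero    = 0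
stirling2 (suc n) (suc k) = suc k * stirling2 n (suc k) + stirling2 n k

sumStirling : ℕ → ℕ → ℕ
sumStirling n zero    = stirling2 n zero
sumStirling n (suc m) = sumStirling n m + stirling2 n (suc m)

-- Bell number b₂(n) = Σ_{k=0}^{n} S(n,k)
-- (equivalently the coefficients of the EGF e^{e^x - 1}).
bell : ℕ → ℕ
bell n = sumStirling n n

ℕtoℚ : ℕ → ℚ
ℕtoℚ n = (+ n) / 1

_^ℚ_ : ℚ → ℕ → ℚ
c ^ℚ zero  = 1ℚ
c ^ℚ suc n = c *ℚ (c ^ℚ n)

-- Write Σₖ S(n,k) f k as Eⁿ 0 n f 0, the n-th iterate of an operator E applied to a
-- weight f on numbers of blocks; bell n is the case f = 1. Iterating E first n and then
-- m times gives bell (n + m) = Σ S(n,b) S(m,a) M(a,b), where M(a,b) counts the partial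
-- matchings between the blocks of a partition of the first n points and those of a
-- partition of the last m. By induction M(a,b) ≤ h(a) h(b), where h has exponential
-- generating function exp(2u + u²); since 2u + u² = (1 + u)² − 1, the Stirling transform
-- of h is 2ⁿ bell n, and the upper bound follows.
--
-- For optimality write c = p/q. Applying the bound with n = m = 2ʲ repeatedly gives
-- q^(j 2ʲ) bell (2ʲ) ≤ p^(j 2ʲ), whereas bell N ≥ R^(N − R) for R ≤ N. With N = 2^(p + i)
-- and R = 2ⁱ, taking R-th roots leaves two exponentials in i whose bases are in the wrong
-- order when p < 2q.

module Submission where

open import Data.Empty using (⊥)
open import Data.Integer using (+_; -[1+_]; +≤+)
import Data.Integer as ℤ
open import Data.Integer.Properties using (pos-*; drop‿+≤+)
open import Data.Nat using (ℕ; zero; suc; _+_; _*_; _^_; _≤_; _<_; pred; z≤n; s≤s; s≤s⁻¹; NonZero; >-nonZero; >-nonZero⁻¹)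
open import Data.Nat.Coprimality using (Coprime; 1-coprimeTo)
import Data.Nat.Coprimality as Coprimality
open import Data.Nat.GeneralisedArithmetic using (iterate)
open import Data.Nat.Properties
open import Data.Nat.Tactic.RingSolver using (solve-∀)
open import Data.Product using (_×_; _,_; ∃-syntax)
open import Data.Rational using (ℚ; mkℚ; 1ℚ; toℚᵘ) renaming (_≤_ to _≤ℚ_; _*_ to _*ℚ_)
import Data.Rational.Properties as ℚ
open import Data.Rational.Properties using (toℚᵘ-homo-*; toℚᵘ-mono-≤; toℚᵘ-cancel-≤; normalize-coprime; drop-*≤*)
open import Data.Rational.Unnormalised using (ℚᵘ; mkℚᵘ; *≤*) renaming (_≤_ to _≤ᵘ_; _*_ to _*ᵘ_; _≃_ to _≃ᵘ_; _/_ to _/ᵘ_)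
import Data.Rational.Unnormalised.Properties as ℚᵘ
open import Data.Sum using (inj₁; inj₂)
open import Function using (_∘_)
open import Relation.Binary.PropositionalEquality
open import Defs

^-distribʳ-* : ∀ m n o → (m * n) ^ o ≡ m ^ o * n ^ o
^-distribʳ-* m n zero    = refl
^-distribʳ-* m n (suc o) = begin
  m * n * (m * n) ^ o      ≡⟨ cong (m * n *_) (^-distribʳ-* m n o) ⟩
  m * n * (m ^ o * n ^ o)  ≡⟨ [m*n]*[o*p]≡[m*o]*[n*p] m n (m ^ o) (n ^ o) ⟩
  m * m ^ o * (n * n ^ o)  ∎
  where open ≡-Reasoning

^-cancelˡ-≤ : ∀ n .{{_ : NonZero n}} {m o} → m ^ n ≤ o ^ n → m ≤ o
^-cancelˡ-≤ n mⁿ≤oⁿ = ≮⇒≥ (λ o<m → <⇒≱ (^-monoˡ-< n o<m) mⁿ≤oⁿ)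

-- Bernoulli's inequality (1 + 1/x)ⁿ ≥ 1 + n/x, cleared of denominators
bernoulli : ∀ x n → x ^ n * (x + n) ≤ x * suc x ^ n
bernoulli x zero    = ≤-reflexive (trans (+-identityʳ (x + 0)) (trans (+-identityʳ x) (sym (*-identityʳ x))))
bernoulli x (suc n) = begin
  x * xⁿ * (x + suc n)              ≤⟨ m≤m+n _ (xⁿ * n) ⟩
  x * xⁿ * (x + suc n) + xⁿ * n     ≡⟨ regroup x n xⁿ ⟩
  suc x * (xⁿ * (x + n))            ≤⟨ *-monoʳ-≤ (suc x) (bernoulli x n) ⟩
  suc x * (x * suc x ^ n)           ≡⟨ x*[y*z]≡y*[x*z] (suc x) x (suc x ^ n) ⟩
  x * suc x ^ suc n                 ∎
  where
  open ≤-Reasoning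
  xⁿ = x ^ n
  regroup : ∀ x n z → x * z * (x + suc n) + z * n ≡ suc x * (z * (x + n))
  regroup = solve-∀
  x*[y*z]≡y*[x*z] : ∀ x y z → x * (y * z) ≡ y * (x * z)
  x*[y*z]≡y*[x*z] = solve-∀

n<2^n : ∀ n → n < 2 ^ n
n<2^n n = begin
  suc n            ≡⟨ *-identityˡ (suc n) ⟨
  1 * suc n        ≡⟨ cong (_* suc n) (^-zeroˡ n) ⟨
  1 ^ n * (1 + n)  ≤⟨ bernoulli 1 n ⟩
  1 * 2 ^ n        ≡⟨ *-identityˡ (2 ^ n) ⟩
  2 ^ n            ∎
  where open ≤-Reasoning

2*m^n<[1+m]^n : ∀ {m n} → m < n → 2 * m ^ n < suc m ^ n
2*m^n<[1+m]^n {zero}      {suc n}     _   = m^n>0 1 (suc n)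
2*m^n<[1+m]^n {m@(suc _)} {n@(suc k)} m<n = *-cancelˡ-≤ m (begin
  m * suc (2 * mⁿ)        ≡⟨ regroup m mⁿ ⟩
  2 * m * mⁿ + m          ≤⟨ +-monoʳ-≤ (2 * m * mⁿ) m≤mⁿ ⟩
  2 * m * mⁿ + mⁿ         ≡⟨ regroup′ m mⁿ ⟩
  mⁿ * (m + suc m)        ≤⟨ *-monoʳ-≤ mⁿ (+-monoʳ-≤ m m<n) ⟩
  mⁿ * (m + n)            ≤⟨ bernoulli m n ⟩
  m * suc m ^ n           ∎)
  where
  open ≤-Reasoning
  mⁿ = m ^ n
  m≤mⁿ : m ≤ mⁿ
  m≤mⁿ = m≤m*n m (m ^ k) {{m^n≢0 m k}}
  regroup : ∀ m x → m * suc (2 * x) ≡ 2 * m * x + m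
  regroup = solve-∀
  regroup′ : ∀ m x → 2 * m * x + x ≡ x * (m + suc m)
  regroup′ = solve-∀

-- with i = x ^ suc s, Bernoulli gives x ^ i * (x + i) ≤ x * y ^ i, while x * x ^ (s + i) = x ^ i * i
x<y⇒x^[s+i]<y^i : ∀ s {x y} .{{_ : NonZero x}} → x < y → ∃[ i ] x ^ (s + i) < y ^ i
x<y⇒x^[s+i]<y^i s {x} {y} x<y = i , *-cancelˡ-< x _ _ (begin-strict
  x * x ^ (s + i)          ≡⟨ ^-distribˡ-+-* x (suc s) i ⟩
  i * x ^ i                ≡⟨ *-comm i (x ^ i) ⟩
  x ^ i * i                <⟨ +-monoˡ-< (x ^ i * i) xⁱ*x>0 ⟩
  x ^ i * x + x ^ i * i    ≡⟨ *-distribˡ-+ (x ^ i) x i ⟨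
  x ^ i * (x + i)          ≤⟨ bernoulli x i ⟩
  x * suc x ^ i            ≤⟨ *-monoʳ-≤ x (^-monoˡ-≤ i x<y) ⟩
  x * y ^ i                ∎)
  where
  open ≤-Reasoning
  i = x ^ suc s
  xⁱ*x>0 : 0 < x ^ i * x
  xⁱ*x>0 = *-mono-≤ (m^n>0 x i) (>-nonZero⁻¹ x)

-- Stirling numbers of the second kind

stirling2-vanish : ∀ {n k} → n < k → stirling2 n k ≡ 0
stirling2-vanish {zero}  {suc k} _ = refl
stirling2-vanish {suc n} {suc k} (s≤s n<k)
  rewrite stirling2-vanish n<k | stirling2-vanish (m<n⇒m<1+n n<k) | *-zeroʳ k = refl

stirling2-diag : ∀ k → stirling2 k k ≡ 1
stirling2-diag zero    = refl
stirling2-diag (suc k) rewrite stirling2-vanish (n<1+n k) | *-zeroʳ k = stirling2-diag k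

stirling2-lower : ∀ t k → k ^ t ≤ stirling2 (t + k) k
stirling2-lower zero    k       = ≤-reflexive (sym (stirling2-diag k))
stirling2-lower (suc t) zero    = z≤n
stirling2-lower (suc t) (suc k) = ≤-trans (*-monoʳ-≤ (suc k) (stirling2-lower t (suc k))) (m≤m+n _ _)

stirling2≤sumStirling : ∀ {k} n m → k ≤ m → stirling2 n k ≤ sumStirling n m
stirling2≤sumStirling n zero    z≤n = ≤-refl
stirling2≤sumStirling n (suc m) k≤1+m with m≤n⇒m<n∨m≡n k≤1+m
... | inj₁ k<1+m = ≤-trans (stirling2≤sumStirling n m (s≤s⁻¹ k<1+m)) (m≤m+n _ _)
... | inj₂ refl  = m≤n+m _ _

bell-lower : ∀ t k → k ^ t ≤ bell (t + k)
bell-lower t k = ≤-trans (stirling2-lower t k) (stirling2≤sumStirling (t + k) (t + k) (m≤n+m k t))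

one : ℕ → ℕ
one _ = 1

_≤̇_ : (ℕ → ℕ) → (ℕ → ℕ) → Set
f ≤̇ g = ∀ b → f b ≤ g b

-- Eⁿ 0 n f b sums f (number of blocks) over the partitions of an n-set into blocks,
-- b of which are given in advance and may stay empty; so Eⁿ 0 n f 0 = Σₖ S(n,k) f k.
-- The offset c counts further given blocks that are not passed on to f.
E : ℕ → (ℕ → ℕ) → ℕ → ℕ
E c f b = (c + b) * f b + f (suc b)

Eⁿ : ℕ → ℕ → (ℕ → ℕ) → ℕ → ℕ
Eⁿ c n f = iterate (E c) f n

E-cong : ∀ c {f g} → f ≗ g → E c f ≗ E c g
E-cong c {f} {g} f≗g b = cong₂ (λ x y → (c + b) * x + y) (f≗g b) (f≗g (suc b))

Eⁿ-cong : ∀ c n {f g} → f ≗ g → Eⁿ c n f ≗ Eⁿ c n g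
Eⁿ-cong c zero    f≗g = f≗g
Eⁿ-cong c (suc n) f≗g = Eⁿ-cong c n (E-cong c f≗g)

E-mono : ∀ c {f g} → f ≤̇ g → E c f ≤̇ E c g
E-mono c f≤g b = +-mono-≤ (*-monoʳ-≤ (c + b) (f≤g b)) (f≤g (suc b))

Eⁿ-mono : ∀ c n {f g} → f ≤̇ g → Eⁿ c n f ≤̇ Eⁿ c n g
Eⁿ-mono c zero    f≤g = f≤g
Eⁿ-mono c (suc n) f≤g = Eⁿ-mono c n (E-mono c f≤g)

E-scale : ∀ c k f → E c (λ b → k * f b) ≗ (λ b → k * E c f b)
E-scale c k f b = regroup (c + b) k (f b) (f (suc b))
  where
  regroup : ∀ x k u v → x * (k * u) + k * v ≡ k * (x * u + v)
  regroup = solve-∀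

Eⁿ-scale : ∀ c n k f → Eⁿ c n (λ b → k * f b) ≗ (λ b → k * Eⁿ c n f b)
Eⁿ-scale c zero    k f b = refl
Eⁿ-scale c (suc n) k f b = trans (Eⁿ-cong c n (E-scale c k f) b) (Eⁿ-scale c n k (E c f) b)

Eⁿ-+ : ∀ c n m f → Eⁿ c (n + m) f ≡ Eⁿ c m (Eⁿ c n f)
Eⁿ-+ c zero    m f = refl
Eⁿ-+ c (suc n) m f = Eⁿ-+ c n m (E c f)

Eⁿ-shift : ∀ n c a f b → Eⁿ c n f (b + a) ≡ Eⁿ (c + a) n (λ x → f (x + a)) b
Eⁿ-shift zero    c a f b = refl
Eⁿ-shift (suc n) c a f b =
  trans (Eⁿ-shift n c a (E c f) b) (Eⁿ-cong (c + a) n E-shift b)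
  where
  E-shift : (λ x → E c f (x + a)) ≗ E (c + a) (λ x → f (x + a))
  E-shift x = cong (λ t → t * f (x + a) + f (suc x + a)) (regroup c x a)
    where
    regroup : ∀ c x a → c + (x + a) ≡ c + a + x
    regroup = solve-∀

stirlingSum : ℕ → ℕ → (ℕ → ℕ) → ℕ
stirlingSum n zero    f = stirling2 n 0 * f 0
stirlingSum n (suc k) f = stirlingSum n k f + stirling2 n (suc k) * f (suc k)

sumStirling≡stirlingSum : ∀ n k → sumStirling n k ≡ stirlingSum n k one
sumStirling≡stirlingSum n zero    = sym (*-identityʳ _)
sumStirling≡stirlingSum n (suc k) = cong₂ _+_ (sumStirling≡stirlingSum n k) (sym (*-identityʳ _))

stirlingSum-suc : ∀ n k f →
  stirlingSum (suc n) k f + stirling2 n k * f (suc k) ≡ stirlingSum n k (E 0 f)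
stirlingSum-suc n zero    f = refl
stirlingSum-suc n (suc k) f = begin
  L + (suc k * s₁ + s₀) * f (suc k) + s₁ * f (suc (suc k))
    ≡⟨ regroup L s₀ s₁ (f (suc k)) (f (suc (suc k))) k ⟩
  (L + s₀ * f (suc k)) + s₁ * E 0 f (suc k)
    ≡⟨ cong (_+ s₁ * E 0 f (suc k)) (stirlingSum-suc n k f) ⟩
  stirlingSum n k (E 0 f) + s₁ * E 0 f (suc k)
    ∎
  where
  open ≡-Reasoning
  L  = stirlingSum (suc n) k f
  s₀ = stirling2 n k
  s₁ = stirling2 n (suc k)
  regroup : ∀ L s₀ s₁ u v k → L + (suc k * s₁ + s₀) * u + s₁ * v
                             ≡ (L + s₀ * u) + s₁ * (suc k * u + v)
  regroup = solve-∀

stirlingSum≡Eⁿ : ∀ n f → stirlingSum n n f ≡ Eⁿ 0 n f 0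
stirlingSum≡Eⁿ zero    f = +-identityʳ (f 0)
stirlingSum≡Eⁿ (suc n) f rewrite stirling2-vanish (n<1+n n) | *-zeroʳ n =
  trans (stirlingSum-suc n n f) (stirlingSum≡Eⁿ n (E 0 f))

bell≡Eⁿ : ∀ n → bell n ≡ Eⁿ 0 n one 0
bell≡Eⁿ n = trans (sumStirling≡stirlingSum n n) (stirlingSum≡Eⁿ n one)

-- Partial matchings

-- matchings a b = Σₖ C(a,k) C(b,k) k! counts the partial matchings between an a-set
-- and a b-set.
matchings : ℕ → ℕ → ℕ
matchings zero    b       = 1
matchings (suc a) zero    = 1
matchings (suc a) (suc b) = matchings a (suc b) + suc b * matchings a b

adjoinBlock : (ℕ → ℕ) → ℕ → ℕ
adjoinBlock g zero    = g zero
adjoinBlock g (suc b) = g (suc b) + suc b * g b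

matchings-zeroʳ : ∀ a → matchings a 0 ≡ 1
matchings-zeroʳ zero    = refl
matchings-zeroʳ (suc a) = refl

matchings-suc : ∀ a → matchings (suc a) ≗ adjoinBlock (matchings a)
matchings-suc a zero    = sym (matchings-zeroʳ a)
matchings-suc a (suc b) = refl

E-adjoinBlock : ∀ c g → E c (adjoinBlock g) ≗ adjoinBlock (E (suc c) g)
E-adjoinBlock c g zero    = regroup c (g 0) (g 1)
  where
  regroup : ∀ c x y → (c + 0) * x + (y + 1 * x) ≡ (suc c + 0) * x + y
  regroup = solve-∀
E-adjoinBlock c g (suc b) = regroup c b (g b) (g (suc b)) (g (suc (suc b)))
  where
  regroup : ∀ c b x y z → (c + suc b) * (y + suc b * x) + (z + suc (suc b) * y)
                        ≡ (suc c + suc b) * y + z + suc b * ((suc c + b) * x + y)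
  regroup = solve-∀

Eⁿ-adjoinBlock : ∀ c n g → Eⁿ c n (adjoinBlock g) ≗ adjoinBlock (Eⁿ (suc c) n g)
Eⁿ-adjoinBlock c zero    g b = refl
Eⁿ-adjoinBlock c (suc n) g b = trans (Eⁿ-cong c n (E-adjoinBlock c g) b) (Eⁿ-adjoinBlock c n (E (suc c) g) b)

Eⁿ-matchings : ∀ n a c → Eⁿ c n (matchings a) 0 ≡ Eⁿ (a + c) n one 0
Eⁿ-matchings n zero    c = refl
Eⁿ-matchings n (suc a) c = begin
  Eⁿ c n (matchings (suc a)) 0          ≡⟨ Eⁿ-cong c n (matchings-suc a) 0 ⟩
  Eⁿ c n (adjoinBlock (matchings a)) 0  ≡⟨ Eⁿ-adjoinBlock c n (matchings a) 0 ⟩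
  Eⁿ (suc c) n (matchings a) 0          ≡⟨ Eⁿ-matchings n a (suc c) ⟩
  Eⁿ (a + suc c) n one 0                ≡⟨ cong (λ c′ → Eⁿ c′ n one 0) (+-suc a c) ⟩
  Eⁿ (suc a + c) n one 0                ∎
  where open ≡-Reasoning

-- A partition of the n-set together with a further given blocks, possibly empty, is a
-- partition of the n-set plus a partial matching of its blocks with the given ones.
Eⁿ-one≡Eⁿ-matchings : ∀ n a → Eⁿ 0 n one a ≡ Eⁿ 0 n (matchings a) 0
Eⁿ-one≡Eⁿ-matchings n a = begin
  Eⁿ 0 n one a              ≡⟨ Eⁿ-shift n 0 a one 0 ⟩
  Eⁿ a n one 0              ≡⟨ cong (λ c → Eⁿ c n one 0) (sym (+-identityʳ a)) ⟩
  Eⁿ (a + 0) n one 0        ≡⟨ Eⁿ-matchings n a 0 ⟨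
  Eⁿ 0 n (matchings a) 0    ∎
  where open ≡-Reasoning

matchings-oneˡ : ∀ b → matchings 1 b ≡ suc b
matchings-oneˡ zero    = refl
matchings-oneˡ (suc b) = cong (suc ∘ suc) (*-identityʳ b)

matchings-oneʳ : ∀ a → matchings a 1 ≡ suc a
matchings-oneʳ zero    = refl
matchings-oneʳ (suc a) = begin
  matchings a 1 + 1 * matchings a 0  ≡⟨ cong₂ (λ x y → x + 1 * y) (matchings-oneʳ a) (matchings-zeroʳ a) ⟩
  suc a + 1                          ≡⟨ +-comm (suc a) 1 ⟩
  suc (suc a)                        ∎
  where open ≡-Reasoning

matchings-recʳ : ∀ a b → matchings (suc a) (suc b) ≡ matchings (suc a) b + suc a * matchings a b
matchings-recʳ a zero = begin
  matchings (suc a) 1                          ≡⟨ matchings-oneʳ (suc a) ⟩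
  suc (suc a)                                  ≡⟨ cong suc (*-identityʳ (suc a)) ⟨
  1 + suc a * 1                                ≡⟨ cong₂ (λ x y → x + suc a * y) (matchings-zeroʳ (suc a)) (matchings-zeroʳ a) ⟨
  matchings (suc a) 0 + suc a * matchings a 0  ∎
  where open ≡-Reasoning
matchings-recʳ zero (suc b) = regroup b
  where
  regroup : ∀ b → 1 + suc (suc b) * 1 ≡ (1 + suc b * 1) + 1 * 1
  regroup = solve-∀
matchings-recʳ (suc a) (suc b) = begin
  matchings (suc a) (suc (suc b)) + suc (suc b) * X
    ≡⟨ cong (_+ suc (suc b) * X) (matchings-recʳ a (suc b)) ⟩
  X + suc a * Y + suc (suc b) * X
    ≡⟨ cong (λ t → X + suc a * Y + (X + suc b * t)) (matchings-recʳ a b) ⟩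
  X + suc a * Y + (X + suc b * (Z + suc a * W))
    ≡⟨ regroup X Y Z W a b ⟩
  X + suc b * Z + (X + suc a * (Y + suc b * W))
    ∎
  where
  open ≡-Reasoning
  X = matchings (suc a) (suc b)
  Y = matchings a (suc b)
  Z = matchings (suc a) b
  W = matchings a b
  regroup : ∀ X Y Z W a b → X + suc a * Y + (X + suc b * (Z + suc a * W))
                          ≡ X + suc b * Z + (X + suc a * (Y + suc b * W))
  regroup = solve-∀

matchings-recˡʳ : ∀ a b → matchings (suc (suc a)) (suc (suc b))
  ≡ 2 * matchings (suc a) (suc b) + suc a * matchings a (suc b)
    + suc b * matchings (suc a) b + suc a * suc b * matchings a b
matchings-recˡʳ a b = begin
  matchings (suc (suc a)) (suc (suc b))
    ≡⟨ matchings-recʳ (suc a) (suc b) ⟩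
  X + suc b * Z + (X + suc a * (Y + suc b * W))
    ≡⟨ regroup X Y Z W a b ⟩
  2 * X + suc a * Y + suc b * Z + suc a * suc b * W
    ∎
  where
  open ≡-Reasoning
  X = matchings (suc a) (suc b)
  Y = matchings a (suc b)
  Z = matchings (suc a) b
  W = matchings a b
  regroup : ∀ X Y Z W a b → X + suc b * Z + (X + suc a * (Y + suc b * W))
                          ≡ 2 * X + suc a * Y + suc b * Z + suc a * suc b * W
  regroup = solve-∀

-- If F(u) is the exponential generating function of f, that of dilate f is F(2u + u²):
-- differentiating gives the recurrence, as (F(2u + u²))′ = 2(1 + u) F′(2u + u²).
-- Since Σₙ (Σₖ S(n,k) f k) xⁿ/n! = F(eˣ − 1) and 2u + u² = (1 + u)² − 1, dilation
-- multiplies the Stirling sums by 2ⁿ (Eⁿ-dilate).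
dilate : (ℕ → ℕ) → ℕ → ℕ
dilate f zero          = f zero
dilate f (suc zero)    = 2 * f 1
dilate f (suc (suc a)) = 2 * dilate (f ∘ suc) (suc a) + 2 * suc a * dilate (f ∘ suc) a

dilate-cong : ∀ a {f g} → f ≗ g → dilate f a ≡ dilate g a
dilate-cong zero          f≗g = f≗g 0
dilate-cong (suc zero)    f≗g = cong (2 *_) (f≗g 1)
dilate-cong (suc (suc a)) f≗g = cong₂ (λ x y → 2 * x + 2 * suc a * y)
  (dilate-cong (suc a) (f≗g ∘ suc)) (dilate-cong a (f≗g ∘ suc))

dilate-+ : ∀ a f g → dilate (λ k → f k + g k) a ≡ dilate f a + dilate g a
dilate-+ zero          f g = refl
dilate-+ (suc zero)    f g = *-distribˡ-+ 2 (f 1) (g 1)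
dilate-+ (suc (suc a)) f g
  rewrite dilate-+ (suc a) (f ∘ suc) (g ∘ suc) | dilate-+ a (f ∘ suc) (g ∘ suc) =
  regroup (suc a) (dilate (f ∘ suc) (suc a)) (dilate (g ∘ suc) (suc a))
                  (dilate (f ∘ suc) a) (dilate (g ∘ suc) a)
  where
  regroup : ∀ a x₁ y₁ x₀ y₀ → 2 * (x₁ + y₁) + 2 * a * (x₀ + y₀)
                            ≡ (2 * x₁ + 2 * a * x₀) + (2 * y₁ + 2 * a * y₀)
  regroup = solve-∀

E-dilate : ∀ f a → E 0 (dilate f) a ≡ 2 * dilate (E 0 f) a
E-dilate f zero          = refl
E-dilate f (suc zero)    = regroup (f 1) (f 2)
  where
  regroup : ∀ u v → 1 * (2 * u) + (2 * (2 * v) + 2 * 1 * u) ≡ 2 * (2 * (1 * u + v))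
  regroup = solve-∀
E-dilate f (suc (suc a)) = begin
  suc (suc a) * (2 * t₁ + 2 * suc a * t₀) + (2 * t₂ + 2 * suc (suc a) * t₁)
    ≡⟨ expand a t₀ t₁ t₂ ⟩
  2 * (suc a * t₁ + t₂) + 4 * t₁ + 2 * suc a * (a * t₀ + t₁) + 4 * suc a * t₀
    ≡⟨ cong₂ (λ x y → 2 * x + 4 * t₁ + 2 * suc a * y + 4 * suc a * t₀) (E-dilate g (suc a)) (E-dilate g a) ⟩
  2 * (2 * e₁) + 4 * t₁ + 2 * suc a * (2 * e₀) + 4 * suc a * t₀
    ≡⟨ collect a e₀ e₁ t₀ t₁ ⟩
  2 * (2 * (e₁ + t₁) + 2 * suc a * (e₀ + t₀))
    ≡⟨ cong₂ (λ x y → 2 * (2 * x + 2 * suc a * y)) (dilate-E∘suc (suc a)) (dilate-E∘suc a) ⟨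
  2 * dilate (E 0 f) (suc (suc a))
    ∎
  where
  open ≡-Reasoning
  g = f ∘ suc
  t₀ = dilate g a
  t₁ = dilate g (suc a)
  t₂ = dilate g (suc (suc a))
  e₀ = dilate (E 0 g) a
  e₁ = dilate (E 0 g) (suc a)
  E∘suc : E 0 f ∘ suc ≗ (λ k → E 0 g k + g k)
  E∘suc k = regroup k (f (suc k)) (f (suc (suc k)))
    where
    regroup : ∀ k u v → suc k * u + v ≡ k * u + v + u
    regroup = solve-∀
  dilate-E∘suc : ∀ k → dilate (E 0 f ∘ suc) k ≡ dilate (E 0 g) k + dilate g k
  dilate-E∘suc k = trans (dilate-cong k E∘suc) (dilate-+ k (E 0 g) g)
  expand : ∀ a t₀ t₁ t₂ → suc (suc a) * (2 * t₁ + 2 * suc a * t₀) + (2 * t₂ + 2 * suc (suc a) * t₁)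
                        ≡ 2 * (suc a * t₁ + t₂) + 4 * t₁ + 2 * suc a * (a * t₀ + t₁) + 4 * suc a * t₀
  expand = solve-∀
  collect : ∀ a e₀ e₁ t₀ t₁ → 2 * (2 * e₁) + 4 * t₁ + 2 * suc a * (2 * e₀) + 4 * suc a * t₀
                            ≡ 2 * (2 * (e₁ + t₁) + 2 * suc a * (e₀ + t₀))
  collect = solve-∀

Eⁿ-dilate : ∀ m f → Eⁿ 0 m (dilate f) ≗ (λ a → 2 ^ m * dilate (Eⁿ 0 m f) a)
Eⁿ-dilate zero    f a = sym (+-identityʳ _)
Eⁿ-dilate (suc m) f a = begin
  Eⁿ 0 m (E 0 (dilate f)) a                  ≡⟨ Eⁿ-cong 0 m (E-dilate f) a ⟩
  Eⁿ 0 m (λ b → 2 * dilate (E 0 f) b) a      ≡⟨ Eⁿ-scale 0 m 2 (dilate (E 0 f)) a ⟩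
  2 * Eⁿ 0 m (dilate (E 0 f)) a              ≡⟨ cong (2 *_) (Eⁿ-dilate m (E 0 f) a) ⟩
  2 * (2 ^ m * dilate (Eⁿ 0 m (E 0 f)) a)    ≡⟨ *-assoc 2 (2 ^ m) _ ⟨
  2 ^ suc m * dilate (Eⁿ 0 (suc m) f) a      ∎
  where open ≡-Reasoning

h : ℕ → ℕ
h = dilate one

Eⁿ-h : ∀ n → Eⁿ 0 n h 0 ≡ 2 ^ n * bell n
Eⁿ-h n = trans (Eⁿ-dilate n one 0) (cong (2 ^ n *_) (sym (bell≡Eⁿ n)))

-- The upper bound

2*h≤h∘suc : ∀ a → 2 * h a ≤ h (suc a)
2*h≤h∘suc zero    = ≤-refl
2*h≤h∘suc (suc a) = m≤m+n _ _

h-pos : ∀ a → 1 ≤ h a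
h-pos zero    = ≤-refl
h-pos (suc a) = ≤-trans (h-pos a) (≤-trans (m≤n*m (h a) 2) (2*h≤h∘suc a))

suc≤2*h : ∀ a → suc a ≤ 2 * h a
suc≤2*h zero    = s≤s z≤n
suc≤2*h (suc a) = begin
  suc (suc a)            ≡⟨ +-comm 1 (suc a) ⟩
  suc a + 1              ≤⟨ +-mono-≤ (≤-trans (suc≤2*h a) (2*h≤h∘suc a)) (h-pos (suc a)) ⟩
  h (suc a) + h (suc a)  ≡⟨ cong (λ x → h (suc a) + x) (+-identityʳ (h (suc a))) ⟨
  2 * h (suc a)          ∎
  where open ≤-Reasoning

-- The four terms of matchings-recˡʳ are dominated one by one by the four terms of
-- h (a + 2) * h (b + 2) expanded through the recurrence of h.
matchings≤h*h : ∀ a b → matchings a b ≤ h a * h b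
matchings≤h*h zero          b             = ≤-trans (h-pos b) (≤-reflexive (sym (+-identityʳ (h b))))
matchings≤h*h (suc zero)    b             = ≤-trans (≤-reflexive (matchings-oneˡ b)) (suc≤2*h b)
matchings≤h*h (suc (suc a)) zero          = ≤-trans (h-pos (suc (suc a))) (≤-reflexive (sym (*-identityʳ _)))
matchings≤h*h (suc (suc a)) (suc zero)    = begin
  matchings (suc (suc a)) 1  ≡⟨ matchings-oneʳ (suc (suc a)) ⟩
  suc (suc (suc a))          ≤⟨ suc≤2*h (suc (suc a)) ⟩
  2 * h (suc (suc a))        ≡⟨ *-comm 2 (h (suc (suc a))) ⟩
  h (suc (suc a)) * 2        ∎
  where open ≤-Reasoning
matchings≤h*h (suc (suc a)) (suc (suc b)) = begin
  matchings (suc (suc a)) (suc (suc b))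
    ≡⟨ matchings-recˡʳ a b ⟩
  2 * matchings (suc a) (suc b) + suc a * matchings a (suc b)
    + suc b * matchings (suc a) b + suc a * suc b * matchings a b
    ≤⟨ +-mono-≤ (+-mono-≤ (+-mono-≤ (*-monoʳ-≤ 2 (matchings≤h*h (suc a) (suc b)))
                                      (*-monoʳ-≤ (suc a) (matchings≤h*h a (suc b))))
                           (*-monoʳ-≤ (suc b) (matchings≤h*h (suc a) b)))
                (*-monoʳ-≤ (suc a * suc b) (matchings≤h*h a b)) ⟩
  2 * (x₁ * y₁) + suc a * (x₀ * y₁) + suc b * (x₁ * y₀) + suc a * suc b * (x₀ * y₀)
    ≤⟨ termwise (suc a) (suc b) x₀ x₁ y₀ y₁ ⟩
  (2 * x₁ + 2 * suc a * x₀) * (2 * y₁ + 2 * suc b * y₀)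
    ∎
  where
  open ≤-Reasoning
  x₀ = h a
  x₁ = h (suc a)
  y₀ = h b
  y₁ = h (suc b)
  termwise : ∀ A B x₀ x₁ y₀ y₁ →
    2 * (x₁ * y₁) + A * (x₀ * y₁) + B * (x₁ * y₀) + A * B * (x₀ * y₀)
      ≤ (2 * x₁ + 2 * A * x₀) * (2 * y₁ + 2 * B * y₀)
  termwise A B x₀ x₁ y₀ y₁ = ≤-trans (m≤m+n _ rest) (≤-reflexive (expand A B x₀ x₁ y₀ y₁))
    where
    rest = 2 * (x₁ * y₁) + 3 * (A * (x₀ * y₁)) + 3 * (B * (x₁ * y₀)) + 3 * (A * B * (x₀ * y₀))
    expand : ∀ A B x₀ x₁ y₀ y₁ →
      2 * (x₁ * y₁) + A * (x₀ * y₁) + B * (x₁ * y₀) + A * B * (x₀ * y₀)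
        + (2 * (x₁ * y₁) + 3 * (A * (x₀ * y₁)) + 3 * (B * (x₁ * y₀)) + 3 * (A * B * (x₀ * y₀)))
      ≡ (2 * x₁ + 2 * A * x₀) * (2 * y₁ + 2 * B * y₀)
    expand = solve-∀

Eⁿ-one≤ : ∀ n a → Eⁿ 0 n one a ≤ 2 ^ n * bell n * h a
Eⁿ-one≤ n a = begin
  Eⁿ 0 n one a                   ≡⟨ Eⁿ-one≡Eⁿ-matchings n a ⟩
  Eⁿ 0 n (matchings a) 0         ≤⟨ Eⁿ-mono 0 n (matchings≤h*h a) 0 ⟩
  Eⁿ 0 n (λ b → h a * h b) 0     ≡⟨ Eⁿ-scale 0 n (h a) h 0 ⟩
  h a * Eⁿ 0 n h 0               ≡⟨ cong (h a *_) (Eⁿ-h n) ⟩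
  h a * (2 ^ n * bell n)         ≡⟨ *-comm (h a) _ ⟩
  2 ^ n * bell n * h a           ∎
  where open ≤-Reasoning

bell-submultiplicative : ∀ n m → bell (n + m) ≤ 2 ^ (n + m) * (bell n * bell m)
bell-submultiplicative n m = begin
  bell (n + m)                                ≡⟨ bell≡Eⁿ (n + m) ⟩
  Eⁿ 0 (n + m) one 0                          ≡⟨ cong (λ f → f 0) (Eⁿ-+ 0 n m one) ⟩
  Eⁿ 0 m (Eⁿ 0 n one) 0                       ≤⟨ Eⁿ-mono 0 m (Eⁿ-one≤ n) 0 ⟩
  Eⁿ 0 m (λ a → 2 ^ n * bell n * h a) 0       ≡⟨ Eⁿ-scale 0 m (2 ^ n * bell n) h 0 ⟩
  2 ^ n * bell n * Eⁿ 0 m h 0                 ≡⟨ cong (2 ^ n * bell n *_) (Eⁿ-h m) ⟩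
  2 ^ n * bell n * (2 ^ m * bell m)           ≡⟨ [m*n]*[o*p]≡[m*o]*[n*p] (2 ^ n) (bell n) (2 ^ m) (bell m) ⟩
  2 ^ n * 2 ^ m * (bell n * bell m)           ≡⟨ cong (_* (bell n * bell m)) (^-distribˡ-+-* 2 n m) ⟨
  2 ^ (n + m) * (bell n * bell m)             ∎
  where open ≤-Reasoning

-- Optimality of the constant 2

SubmultiplicativeWith : ℕ → ℕ → Set
SubmultiplicativeWith p q = ∀ n m → q ^ (n + m) * bell (n + m) ≤ p ^ (n + m) * (bell n * bell m)

module _ {p q : ℕ} (submult : SubmultiplicativeWith p q) where

  bell-bound-+ : ∀ N N′ e e′ → q ^ e * bell N ≤ p ^ e → q ^ e′ * bell N′ ≤ p ^ e′ →
                 q ^ (N + N′ + (e + e′)) * bell (N + N′) ≤ p ^ (N + N′ + (e + e′))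
  bell-bound-+ N N′ e e′ bN bN′ = begin
    q ^ (N + N′ + (e + e′)) * bell (N + N′)
      ≡⟨ cong (_* bell (N + N′)) (^-split q) ⟩
    q ^ (N + N′) * (q ^ e * q ^ e′) * bell (N + N′)
      ≡⟨ regroup (q ^ (N + N′)) (q ^ e) (q ^ e′) (bell (N + N′)) ⟩
    q ^ (N + N′) * bell (N + N′) * (q ^ e * q ^ e′)
      ≤⟨ *-monoˡ-≤ (q ^ e * q ^ e′) (submult N N′) ⟩
    p ^ (N + N′) * (bell N * bell N′) * (q ^ e * q ^ e′)
      ≡⟨ regroup′ (p ^ (N + N′)) (bell N) (bell N′) (q ^ e) (q ^ e′) ⟩
    p ^ (N + N′) * ((q ^ e * bell N) * (q ^ e′ * bell N′))
      ≤⟨ *-monoʳ-≤ (p ^ (N + N′)) (*-mono-≤ bN bN′) ⟩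
    p ^ (N + N′) * (p ^ e * p ^ e′)
      ≡⟨ ^-split p ⟨
    p ^ (N + N′ + (e + e′))
      ∎
    where
    open ≤-Reasoning
    ^-split : ∀ b → b ^ (N + N′ + (e + e′)) ≡ b ^ (N + N′) * (b ^ e * b ^ e′)
    ^-split b = trans (^-distribˡ-+-* b (N + N′) (e + e′)) (cong (b ^ (N + N′) *_) (^-distribˡ-+-* b e e′))
    regroup : ∀ a x y b → a * (x * y) * b ≡ a * b * (x * y)
    regroup = solve-∀
    regroup′ : ∀ a u v x y → a * (u * v) * (x * y) ≡ a * ((x * u) * (y * v))
    regroup′ = solve-∀

  bell-2^-bound : ∀ j → q ^ (j * 2 ^ j) * bell (2 ^ j) ≤ p ^ (j * 2 ^ j)
  bell-2^-bound zero    = ≤-refl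
  bell-2^-bound (suc j) =
    subst₂ (λ e N → q ^ e * bell N ≤ p ^ e) (sym (exponent j N)) (cong (λ x → N + x) (sym (+-identityʳ N)))
      (bell-bound-+ N N (j * N) (j * N) (bell-2^-bound j) (bell-2^-bound j))
    where
    N = 2 ^ j
    exponent : ∀ j N → suc j * (2 * N) ≡ N + N + (j * N + j * N)
    exponent = solve-∀

  -- N = 2 ^ (s + i) splits into R = 2 ^ i groups of T = 2 ^ s, so bell N ≥ R ^ ((T - 1) R)
  -- by bell-lower, and the bound of bell-2^-bound is an R-th power.
  bell-bound-rooted : ∀ s i → (q ^ 2 ^ s) ^ (s + i) * (2 ^ pred (2 ^ s)) ^ i ≤ (p ^ 2 ^ s) ^ (s + i)
  bell-bound-rooted s i = ^-cancelˡ-≤ R {{m^n≢0 2 i}} (begin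
    ((q ^ T) ^ j * (2 ^ t) ^ i) ^ R       ≡⟨ ^-distribʳ-* ((q ^ T) ^ j) ((2 ^ t) ^ i) R ⟩
    ((q ^ T) ^ j) ^ R * ((2 ^ t) ^ i) ^ R ≡⟨ cong₂ _*_ (^-jN q) ^-tR ⟩
    q ^ (j * N) * R ^ (t * R)             ≤⟨ *-monoʳ-≤ (q ^ (j * N)) (bell-lower (t * R) R) ⟩
    q ^ (j * N) * bell (t * R + R)        ≡⟨ cong (λ n → q ^ (j * N) * bell n) N≡tR+R ⟨
    q ^ (j * N) * bell N                  ≤⟨ bell-2^-bound j ⟩
    p ^ (j * N)                           ≡⟨ ^-jN p ⟨
    ((p ^ T) ^ j) ^ R                     ∎)
    where
    open ≤-Reasoning
    T = 2 ^ s
    t = pred T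
    R = 2 ^ i
    j = s + i
    N = 2 ^ j
    N≡TR : N ≡ T * R
    N≡TR = ^-distribˡ-+-* 2 s i
    N≡tR+R : N ≡ t * R + R
    N≡tR+R = trans N≡TR (trans (cong (_* R) (sym (suc-pred T {{m^n≢0 2 s}}))) (+-comm R (t * R)))
    ^-jN : ∀ b → ((b ^ T) ^ j) ^ R ≡ b ^ (j * N)
    ^-jN b = begin-equality
      ((b ^ T) ^ j) ^ R  ≡⟨ cong (_^ R) (^-*-assoc b T j) ⟩
      (b ^ (T * j)) ^ R  ≡⟨ ^-*-assoc b (T * j) R ⟩
      b ^ (T * j * R)    ≡⟨ cong (b ^_) (trans (regroup T j R) (cong (j *_) (sym N≡TR))) ⟩
      b ^ (j * N)        ∎
      where
      regroup : ∀ T j R → T * j * R ≡ j * (T * R)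
      regroup = solve-∀
    ^-tR : ((2 ^ t) ^ i) ^ R ≡ R ^ (t * R)
    ^-tR = begin-equality
      ((2 ^ t) ^ i) ^ R  ≡⟨ cong (_^ R) (^-*-assoc 2 t i) ⟩
      (2 ^ (t * i)) ^ R  ≡⟨ cong (λ e → (2 ^ e) ^ R) (*-comm t i) ⟩
      (2 ^ (i * t)) ^ R  ≡⟨ cong (_^ R) (^-*-assoc 2 i t) ⟨
      (R ^ t) ^ R        ≡⟨ ^-*-assoc R t R ⟩
      R ^ (t * R)        ∎

  -- For p < 2q the base X of the right-hand side of bell-bound-rooted (with s = p) is
  -- smaller than the base Y = Q * W of its left-hand side, which is absurd for large i.
  submultiplicativeWith⇒2q≤p : .{{_ : NonZero q}} → 2 * q ≤ p
  submultiplicativeWith⇒2q≤p = ≮⇒≥ p<2q⇒⊥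
    where
    q≤p : q ≤ p
    q≤p = subst₂ _≤_ (trans (*-identityʳ (q * 1)) (*-identityʳ q))
                     (trans (*-identityʳ (p * 1)) (*-identityʳ p)) (submult 1 0)
    instance
      p≢0 : NonZero p
      p≢0 = >-nonZero (≤-trans (>-nonZero⁻¹ q) q≤p)
    p<2q⇒⊥ : p < 2 * q → ⊥
    p<2q⇒⊥ p<2q = let (i , Xᵖ⁺ⁱ<Yⁱ) = x<y⇒x^[s+i]<y^i p {{m^n≢0 p T}} X<Y in <⇒≱ Xᵖ⁺ⁱ<Yⁱ (Yⁱ≤Xᵖ⁺ⁱ i)
      where
      T = 2 ^ p
      X = p ^ T
      Q = q ^ T
      W = 2 ^ pred T
      Y = Q * W
      X<Y : X < Y
      X<Y = *-cancelˡ-< 2 X Y (begin-strict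
        2 * X        <⟨ 2*m^n<[1+m]^n (n<2^n p) ⟩
        suc p ^ T    ≤⟨ ^-monoˡ-≤ T p<2q ⟩
        (2 * q) ^ T  ≡⟨ ^-distribʳ-* 2 q T ⟩
        2 ^ T * Q    ≡⟨ cong (λ e → 2 ^ e * Q) (suc-pred T {{m^n≢0 2 p}}) ⟨
        2 * W * Q    ≡⟨ *-assoc 2 W Q ⟩
        2 * (W * Q)  ≡⟨ cong (2 *_) (*-comm W Q) ⟩
        2 * Y        ∎)
        where open ≤-Reasoning
      Yⁱ≤Xᵖ⁺ⁱ : ∀ i → Y ^ i ≤ X ^ (p + i)
      Yⁱ≤Xᵖ⁺ⁱ i = begin
        Y ^ i                  ≡⟨ ^-distribʳ-* Q W i ⟩
        Q ^ i * W ^ i          ≤⟨ *-monoˡ-≤ (W ^ i) (m≤n*m (Q ^ i) (Q ^ p) {{m^n≢0 Q p {{m^n≢0 q T}}}}) ⟩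
        Q ^ p * Q ^ i * W ^ i  ≡⟨ cong (_* W ^ i) (^-distribˡ-+-* Q p i) ⟨
        Q ^ (p + i) * W ^ i    ≤⟨ bell-bound-rooted p i ⟩
        X ^ (p + i)            ∎
        where open ≤-Reasoning

toℚᵘ-ℕtoℚ : ∀ a → toℚᵘ (ℕtoℚ a) ≡ + a /ᵘ 1
toℚᵘ-ℕtoℚ a rewrite normalize-coprime (Coprimality.sym (1-coprimeTo a)) = refl

/ᵘ-* : ∀ a b c d .{{_ : NonZero b}} .{{_ : NonZero d}} →
       (+ a /ᵘ b) *ᵘ (+ c /ᵘ d) ≡ (+ (a * c) /ᵘ (b * d)) {{m*n≢0 b d}}
/ᵘ-* a (suc b) c (suc d) = cong (λ n → mkℚᵘ n _) (sym (pos-* a c))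

/ᵘ-≤⁻ : ∀ a b c d .{{_ : NonZero b}} .{{_ : NonZero d}} → + a /ᵘ b ≤ᵘ + c /ᵘ d → a * d ≤ c * b
/ᵘ-≤⁻ a (suc b) c (suc d) (*≤* le) = drop‿+≤+ (subst₂ ℤ._≤_ (sym (pos-* a (suc d))) (sym (pos-* c (suc b))) le)

/ᵘ-≤⁺ : ∀ a b c d .{{_ : NonZero b}} .{{_ : NonZero d}} → a * d ≤ c * b → + a /ᵘ b ≤ᵘ + c /ᵘ d
/ᵘ-≤⁺ a (suc b) c (suc d) le = *≤* (subst₂ ℤ._≤_ (pos-* a (suc d)) (pos-* c (suc b)) (+≤+ le))

module _ (p d : ℕ) .(coprime : Coprime p (suc d)) where

  private
    c = mkℚ (+ p) d coprime
    q = suc d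
    infixl 7 _/q^_
    _/q^_ : ℕ → ℕ → ℚᵘ
    a /q^ k = (+ a /ᵘ q ^ k) {{m^n≢0 q k}}

  toℚᵘ-^ℚ : ∀ k → toℚᵘ (c ^ℚ k) ≃ᵘ p ^ k /q^ k
  toℚᵘ-^ℚ zero    = ℚᵘ.≃-refl
  toℚᵘ-^ℚ (suc k) = ℚᵘ.≃-trans (toℚᵘ-homo-* c (c ^ℚ k))
    (ℚᵘ.≃-trans (ℚᵘ.*-congˡ {toℚᵘ c} (toℚᵘ-^ℚ k)) (ℚᵘ.≃-reflexive (/ᵘ-* p q (p ^ k) (q ^ k) {{_}} {{m^n≢0 q k}})))

  ℚ-bound⇒ℕ-bound : ∀ k x u v → ℕtoℚ x ≤ℚ c ^ℚ k *ℚ (ℕtoℚ u *ℚ ℕtoℚ v) → q ^ k * x ≤ p ^ k * (u * v)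
  ℚ-bound⇒ℕ-bound k x u v le =
    subst₂ _≤_ (trans (cong (x *_) (*-identityʳ (q ^ k))) (*-comm x (q ^ k))) (*-identityʳ _)
      (/ᵘ-≤⁻ x 1 (p ^ k * (u * v)) (q ^ k * 1) {{_}} {{qᵏ*1≢0}} (begin
        + x /ᵘ 1
          ≡⟨ toℚᵘ-ℕtoℚ x ⟨
        toℚᵘ (ℕtoℚ x)
          ≤⟨ toℚᵘ-mono-≤ le ⟩
        toℚᵘ (c ^ℚ k *ℚ (ℕtoℚ u *ℚ ℕtoℚ v))
          ≃⟨ toℚᵘ-homo-* (c ^ℚ k) (ℕtoℚ u *ℚ ℕtoℚ v) ⟩
        toℚᵘ (c ^ℚ k) *ᵘ toℚᵘ (ℕtoℚ u *ℚ ℕtoℚ v)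
          ≃⟨ ℚᵘ.*-cong (toℚᵘ-^ℚ k) (toℚᵘ-homo-* (ℕtoℚ u) (ℕtoℚ v)) ⟩
        (p ^ k /q^ k) *ᵘ (toℚᵘ (ℕtoℚ u) *ᵘ toℚᵘ (ℕtoℚ v))
          ≡⟨ cong₂ (λ U V → (p ^ k /q^ k) *ᵘ (U *ᵘ V)) (toℚᵘ-ℕtoℚ u) (toℚᵘ-ℕtoℚ v) ⟩
        (p ^ k /q^ k) *ᵘ ((+ u /ᵘ 1) *ᵘ (+ v /ᵘ 1))
          ≡⟨ cong ((p ^ k /q^ k) *ᵘ_) (/ᵘ-* u 1 v 1) ⟩
        (p ^ k /q^ k) *ᵘ (+ (u * v) /ᵘ 1)
          ≡⟨ /ᵘ-* (p ^ k) (q ^ k) (u * v) 1 {{m^n≢0 q k}} ⟩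
        (+ (p ^ k * (u * v)) /ᵘ (q ^ k * 1)) {{qᵏ*1≢0}}
          ∎))
    where
    open ℚᵘ.≤-Reasoning
    qᵏ*1≢0 : NonZero (q ^ k * 1)
    qᵏ*1≢0 = m*n≢0 (q ^ k) 1 {{m^n≢0 q k}}

two-is-optimal : (c : ℚ)
  → ((n m : ℕ) → ℕtoℚ (bell (n + m)) ≤ℚ (c ^ℚ (n + m)) *ℚ (ℕtoℚ (bell n) *ℚ ℕtoℚ (bell m)))
  → ℕtoℚ 2 ≤ℚ c
two-is-optimal (mkℚ (+ p) d coprime) bound =
  toℚᵘ-cancel-≤ (subst (_≤ᵘ + p /ᵘ suc d) (sym (toℚᵘ-ℕtoℚ 2)) (/ᵘ-≤⁺ 2 1 p (suc d) 2q≤p))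
  where
  2q≤p : 2 * suc d ≤ p * 1
  2q≤p = subst (2 * suc d ≤_) (sym (*-identityʳ p)) (submultiplicativeWith⇒2q≤p
    (λ n m → ℚ-bound⇒ℕ-bound p d coprime (n + m) (bell (n + m)) (bell n) (bell m) (bound n m)))
two-is-optimal c@(mkℚ -[1+ n ] d _) bound
  with drop-*≤* (subst (1ℚ ≤ℚ_) (trans (ℚ.*-identityʳ (c *ℚ 1ℚ)) (ℚ.*-identityʳ c)) (bound 1 0))
... | ()

mainTheorem6 : ((n m : ℕ) → bell (n + m) ≤ 2 ^ (n + m) * (bell n * bell m))
    × ((c : ℚ)
      → ((n m : ℕ) → ℕtoℚ (bell (n + m)) ≤ℚ (c ^ℚ (n + m)) *ℚ (ℕtoℚ (bell n) *ℚ ℕtoℚ (bell m)))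
      → ℕtoℚ 2 ≤ℚ c)
mainTheorem6 = bell-submultiplicative , two-is-optimal
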